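{- Let $m\ge2$ be an integer. If $n$ is an almost-square with $(m-1)^2<n\le m(m-1)$, then $s(n)=2m-1$; and if $n$ is an almost-square with $m(m-1)<n\le m^2$, then $s(n)=2m$.
   Context: For a positive integer $n$, let $s(n)=\min_{d\mid n}(d+n/d)$ and $F(n)=n/s(n)$. A positive integer $n$ is an almost-square if $F(k)\le F(n)$ for all positive integers $k\le n$. -}

module Defs where

open import Data.Nat using (ℕ; zero; suc; _+_; _*_; _≤_; _<_; _⊓_)
open import Data.Nat.Divisibility using (_∣?_)
open import Data.Nat.DivMod using (_/_)
open import Data.Integer using (+_)
open import Data.Rational using (ℚ) renaming (_/_ to _/ℚ_; _≤_ to _≤ℚ_)
open import Relation.Nullary.Decidable using (yes; no)
open import Data.Product using (_×_)
open import Data.Nat using (pred)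

-- minDiv n k = min { d + n/d : 1 ≤ d ≤ k, d ∣ n }, with n + 1 as the
-- starting value (which equals the d = 1 term 1 + n/1, so for n ≥ 1 this
-- does not change the minimum).
minDiv : ℕ → ℕ → ℕ
minDiv n zero = suc n
minDiv n (suc k) with suc k ∣? n
... | yes _ = (suc k + n / suc k) ⊓ minDiv n k
... | no  _ = minDiv n k

-- s(n) = min_{d ∣ n} (d + n/d); every divisor d of n ≥ 1 satisfies d ≤ n.
s : ℕ → ℕ
s n = minDiv n n

-- s n is positive, packaged so that F can divide by it.
s-pred : ℕ → ℕ
s-pred n = pred (s n)

F : ℕ → ℚ
-- for n ≥ 1, s n ≥ 2 so suc (s-pred n) = s n; this only supplies NonZero.
F n = (+ n) /ℚ suc (s-pred n)

AlmostSquare : ℕ → Set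
AlmostSquare n = (1 ≤ n) × (∀ k → 1 ≤ k → k ≤ n → F k ≤ℚ F n)

{-# OPTIONS --safe #-}
-- AM-GM gives d + n/d ≥ 2√n for every divisor d, so s(n)² ≥ 4n bounds s(n) from below.
-- For the upper bound compare the almost-square n with a product k = d·e ≤ n: F(k) ≤ F(n)
-- says k·s(n) ≤ n·s(k) ≤ n·(d + e). With k = (m-1)², s(n) ≥ 2m would force n ≥ m(m-1),
-- i.e. n = m(m-1), whose s is 2m-1. With k = m(m-1), s(n) > 2m is incompatible with
-- n < m², while n = m² has s(n) ≤ m + m directly.
module Submission where

open import Defs
open import Data.Nat using (ℕ; zero; suc; _+_; _*_; _∸_; _≤_; _<_; z≤n; s≤s; z<s; NonZero; >-nonZero; >-nonZero⁻¹)
open import Data.Nat.Properties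
open import Data.Nat.Divisibility using (_∣_; _∣?_; m∣m*n)
open import Data.Nat.DivMod using (_/_; m*n/n≡m; m*[n/m]≡n)
open import Data.Nat.Tactic.RingSolver using (solve-∀; solve)
open import Data.List using (_∷_; [])
open import Data.Integer using (+_) renaming (_≤_ to _≤ℤ_)
open import Data.Integer.Properties using (pos-*; drop‿+≤+)
open import Data.Rational using () renaming (_≤_ to _≤ℚ_)
open import Data.Rational.Properties using (toℚᵘ-mono-≤; toℚᵘ-fromℚᵘ)
open import Data.Rational.Unnormalised using (mkℚᵘ; *≤*)
open import Data.Rational.Unnormalised.Properties using (≤-respˡ-≃; ≤-respʳ-≃)
open import Data.Product using (_×_; _,_)
open import Data.Sum using (inj₁; inj₂; [_,_]′)
open import Function using (_∘_)
open import Relation.Nullary using (yes; no; contradiction)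
open import Relation.Binary.PropositionalEquality

4*[m*n]≤[m+n]*[m+n] : ∀ m n → 4 * (m * n) ≤ (m + n) * (m + n)
4*[m*n]≤[m+n]*[m+n] m n = [ ordered , swap ∘ ordered ]′ (≤-total m n)
  where
  square-sum : ∀ m t → (m + (m + t)) * (m + (m + t)) ≡ 4 * (m * (m + t)) + t * t
  square-sum = solve-∀

  ordered : ∀ {m n} → m ≤ n → 4 * (m * n) ≤ (m + n) * (m + n)
  ordered {m} m≤n with t , refl ← m≤n⇒∃[o]m+o≡n m≤n =
    subst (4 * (m * (m + t)) ≤_) (sym (square-sum m t)) (m≤m+n _ (t * t))

  swap : 4 * (n * m) ≤ (n + m) * (n + m) → 4 * (m * n) ≤ (m + n) * (m + n)
  swap = subst₂ _≤_ (cong (4 *_) (*-comm n m)) (cong (λ x → x * x) (+-comm n m))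

minDiv-≤ : ∀ {n d} k .{{_ : NonZero d}} → d ∣ n → d ≤ k → minDiv n k ≤ d + n / d
minDiv-≤ {d = d} zero _ d≤0 = contradiction (≤-trans (>-nonZero⁻¹ d) d≤0) λ ()
minDiv-≤ {n} (suc k) d∣n d≤1+k with suc k ∣? n | m≤n⇒m<n∨m≡n d≤1+k
... | yes _   | inj₁ (s≤s d≤k) = ≤-trans (m⊓n≤n _ _) (minDiv-≤ k d∣n d≤k)
... | yes _   | inj₂ refl      = m⊓n≤m _ _
... | no  _   | inj₁ (s≤s d≤k) = minDiv-≤ k d∣n d≤k
... | no  d∤n | inj₂ refl      = contradiction d∣n d∤n

4*n≤minDiv*minDiv : ∀ n k → 4 * n ≤ minDiv n k * minDiv n k
4*n≤minDiv*minDiv n zero =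
  subst (λ x → 4 * x ≤ suc n * suc n) (*-identityˡ n) (4*[m*n]≤[m+n]*[m+n] 1 n)
4*n≤minDiv*minDiv n (suc k) with suc k ∣? n
... | no  _   = 4*n≤minDiv*minDiv n k
... | yes d∣n with ⊓-sel (suc k + n / suc k) (minDiv n k)
...   | inj₁ eq rewrite eq =
  subst (λ x → 4 * x ≤ (suc k + n / suc k) * (suc k + n / suc k))
        (m*[n/m]≡n d∣n) (4*[m*n]≤[m+n]*[m+n] (suc k) (n / suc k))
...   | inj₂ eq rewrite eq = 4*n≤minDiv*minDiv n k

4*n≤s*s : ∀ n → 4 * n ≤ s n * s n
4*n≤s*s n = 4*n≤minDiv*minDiv n n

s[m*n]≤m+n : ∀ m n .{{_ : NonZero m}} → s (m * n) ≤ m + n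
s[m*n]≤m+n m zero rewrite *-zeroʳ m = ≤-trans (>-nonZero⁻¹ m) (m≤m+n m 0)
s[m*n]≤m+n m n@(suc _) =
  subst (λ x → s (m * n) ≤ m + x) (trans (cong (_/ m) (*-comm m n)) (m*n/n≡m n m))
        (minDiv-≤ (m * n) (m∣m*n n) (m≤m*n m n))

suc[s-pred]≡s : ∀ n → suc (s-pred n) ≡ s n
suc[s-pred]≡s zero = refl
suc[s-pred]≡s n@(suc _) with s n | 4*n≤s*s n
... | suc _ | _ = refl

F≤F⇒*≤* : ∀ k n → F k ≤ℚ F n → k * s n ≤ n * s k
F≤F⇒*≤* k n Fk≤Fn
  with *≤* le ← ≤-respˡ-≃ (toℚᵘ-fromℚᵘ (mkℚᵘ (+ k) (s-pred k)))
                  (≤-respʳ-≃ (toℚᵘ-fromℚᵘ (mkℚᵘ (+ n) (s-pred n))) (toℚᵘ-mono-≤ Fk≤Fn)) =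
  subst₂ (λ a b → k * a ≤ n * b) (suc[s-pred]≡s n) (suc[s-pred]≡s k)
    (drop‿+≤+ (subst₂ _≤ℤ_ (sym (pos-* k _)) (sym (pos-* n _)) le))

almostSquare⇒*≤* : ∀ {n k} → AlmostSquare n → k ≤ n → k * s n ≤ n * s k
almostSquare⇒*≤* {k = zero}  _               _   = z≤n
almostSquare⇒*≤* {n} {suc k} (_ , maximal) k≤n = F≤F⇒*≤* (suc k) n (maximal (suc k) (s≤s z≤n) k≤n)

almostSquare⇒d*e*s≤n*[d+e] : ∀ {n} d e → AlmostSquare n → d * e ≤ n → d * e * s n ≤ n * (d + e)
almostSquare⇒d*e*s≤n*[d+e] zero        e _  _   = z≤n
almostSquare⇒d*e*s≤n*[d+e] {n} d@(suc _) e as de≤n =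
  ≤-trans (almostSquare⇒*≤* as de≤n) (*-monoʳ-≤ n (s[m*n]≤m+n d e))

m*m<4*n⇒m<s : ∀ {n} m → m * m < 4 * n → m < s n
m*m<4*n⇒m<s {n} m m²<4n = ≰⇒> λ sn≤m → <⇒≱ m²<4n (≤-trans (4*n≤s*s n) (*-mono-≤ sn≤m sn≤m))

s≡[1+a]+a : ∀ {n} a .{{_ : NonZero a}} → AlmostSquare n → a * a < n → n ≤ suc a * a →
            s n ≡ suc a + a
s≡[1+a]+a {n} a as lo hi = ≤-antisym upper lower
  where
  open ≤-Reasoning

  lower : a + a < s n
  lower = m*m<4*n⇒m<s {n} (a + a) (begin-strict
    (a + a) * (a + a) ≡⟨ solve (a ∷ []) ⟩
    4 * (a * a)       <⟨ *-monoʳ-< 4 lo ⟩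
    4 * n             ∎)

  a+a≢0 : NonZero (a + a)
  a+a≢0 = >-nonZero (≤-trans (>-nonZero⁻¹ a) (m≤m+n a a))

  pronic≡n : suc a + a < s n → suc a * a ≡ n
  pronic≡n 2a+1<sn = ≤-antisym (*-cancelʳ-≤ (suc a * a) n (a + a) {{a+a≢0}} (begin
    suc a * a * (a + a)       ≡⟨ solve (a ∷ []) ⟩
    a * a * suc (suc a + a)   ≤⟨ *-monoʳ-≤ (a * a) 2a+1<sn ⟩
    a * a * s n               ≤⟨ almostSquare⇒d*e*s≤n*[d+e] a a as (<⇒≤ lo) ⟩
    n * (a + a)               ∎)) hi

  upper : s n ≤ suc a + a
  upper = ≮⇒≥ λ 2a+1<sn →
    <⇒≱ 2a+1<sn (subst (λ k → s k ≤ suc a + a) (pronic≡n 2a+1<sn) (s[m*n]≤m+n (suc a) a))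

s≡[1+a]+[1+a] : ∀ {n} a .{{_ : NonZero a}} → AlmostSquare n → suc a * a < n → n ≤ suc a * suc a →
                s n ≡ suc a + suc a
s≡[1+a]+[1+a] {n} a as lo hi = ≤-antisym upper lower
  where
  open ≤-Reasoning

  lower : suc a + suc a ≤ s n
  lower = subst (_≤ s n) (cong suc (sym (+-suc a a))) (m*m<4*n⇒m<s {n} (suc a + a) (begin-strict
    (suc a + a) * (suc a + a)     <⟨ m<m+n _ z<s ⟩
    (suc a + a) * (suc a + a) + 3 ≡⟨ solve (a ∷ []) ⟩
    4 * suc (suc a * a)           ≤⟨ *-monoʳ-≤ 4 lo ⟩
    4 * n                         ∎))

  upper : s n ≤ suc a + suc a
  upper with m≤n⇒m<n∨m≡n hi
  ... | inj₂ refl = s[m*n]≤m+n (suc a) (suc a)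
  ... | inj₁ n<[1+a]² = ≮⇒≥ λ 2a+2<sn → <⇒≱ (m<m+n _ (>-nonZero⁻¹ a)) (begin
    suc a * suc a * (suc a + a) + a               ≡⟨ solve (a ∷ []) ⟩
    suc a * a * suc (suc a + suc a) + (suc a + a) ≤⟨ +-monoˡ-≤ (suc a + a) (*-monoʳ-≤ (suc a * a) 2a+2<sn) ⟩
    suc a * a * s n + (suc a + a)                 ≤⟨ +-monoˡ-≤ (suc a + a) (almostSquare⇒d*e*s≤n*[d+e] (suc a) a as (<⇒≤ lo)) ⟩
    n * (suc a + a) + (suc a + a)                 ≡⟨ +-comm (n * (suc a + a)) (suc a + a) ⟩
    suc n * (suc a + a)                           ≤⟨ *-monoˡ-≤ (suc a + a) n<[1+a]² ⟩
    suc a * suc a * (suc a + a)                   ∎)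

2*m≡m+m : ∀ m → 2 * m ≡ m + m
2*m≡m+m m = cong (_+_ m) (+-identityʳ m)

lemma4 : (m : ℕ) → 2 ≤ m → (n : ℕ) → AlmostSquare n →
             ((m ∸ 1) * (m ∸ 1) < n → n ≤ m * (m ∸ 1) → s n ≡ 2 * m ∸ 1)
             × (m * (m ∸ 1) < n → n ≤ m * m → s n ≡ 2 * m)
lemma4 m@(suc a@(suc _)) _ n as =
  (λ lo hi → trans (s≡[1+a]+a a as lo hi) (sym (trans (cong (_∸ 1) (2*m≡m+m m)) (+-comm a m)))) ,
  (λ lo hi → trans (s≡[1+a]+[1+a] a as lo hi) (sym (2*m≡m+m m)))
lemma4 (suc zero) (s≤s ()) _ _
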